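{- Let $G$ be a connected graph with at least two vertices. Let $u_0,u_1$ be adjacent vertices of $G$, let $U=N_G(u_0)\setminus\{u_1\}$, and let $H=G-U$. For $i\in\mathbb{N}\cup\{0\}$ let $N_i=\{v\in V(H): d_H(u_0,v)=i\}$. Then: (a) If $G$ is claw-free and $i\ge 2$, then any two distinct vertices of $N_i$ having a common neighbor in $N_{i-1}$ are adjacent. In particular, $N_2$ is a clique. (b) If $G$ is claw-free and bull-free, then each $N_i$ is a clique, and for every $i\ge 1$ every vertex of $N_i$ is adjacent to every vertex of $N_{i-1}$. (c) If $G$ is claw-free, net-free and antenna-free, then every $N_i$ is a clique and contains a vertex adjacent to all vertices of $N_{i+1}$. (d) If $G$ is claw-free and net-free, then each $G[N_i]$ has independence number at most $2$.
   Context: All graphs are finite, simple and undirected. "$H$-free" means having no induced subgraph isomorphic to $H$. The claw is $K_{1,3}$. The bull is a triangle $abc$ together with two further vertices $d,e$, where $d$ is adjacent only to $a$ and $e$ is adjacent only to $b$. The net is a triangle with one pendant vertex attached to each triangle vertex. The antenna is the 6-vertex graph obtained from the house, which is a 4-cycle $p_1p_2p_3p_4$ plus a vertex $p_5$ adjacent exactly to $p_1$ and $p_2$, by adding a vertex $p_6$ adjacent only to $p_5$. -}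

module Defs where

open import Data.Nat using (ℕ; zero; suc; _<_; _≡ᵇ_)
open import Data.Fin using (Fin; toℕ)
open import Data.Bool using (Bool; true; false; _∧_; _∨_)
open import Data.List using (List; []; _∷_)
open import Data.Bool.ListAction using (any)
open import Data.Unit using (⊤)
open import Data.Product using (Σ; _×_; _,_; ∃)
open import Data.Sum using (_⊎_)
open import Data.Empty using (⊥)
open import Relation.Nullary using (¬_)
open import Relation.Binary.PropositionalEquality using (_≡_; _≢_)
open import Function.Definitions using (Injective)

record Graph (n : ℕ) : Set where
  field
    adj    : Fin n → Fin n → Bool
    sym    : ∀ u v → adj u v ≡ adj v u
    irrefl : ∀ v → adj v v ≡ false
open Graph public

module _ {n : ℕ} (G : Graph n) where

  Adj : Fin n → Fin n → Set
  Adj u v = adj G u v ≡ true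

  data Walk (S : Fin n → Set) : Fin n → Fin n → ℕ → Set where
    nil  : ∀ {u} → S u → Walk S u u 0
    cons : ∀ {u w v k} → S u → Adj u w → Walk S w v k → Walk S u v (suc k)

  -- distance in the induced subgraph G[S]: d_{G[S]}(u,v) = i
  Dist : (S : Fin n → Set) → Fin n → Fin n → ℕ → Set
  Dist S u v i = Walk S u v i × (∀ j → j < i → ¬ Walk S u v j)

  Connected : Set
  Connected = ∀ u v → ∃ λ k → Walk (λ _ → ⊤) u v k

  Free : (k : ℕ) → (Fin k → Fin k → Bool) → Set
  Free k P = ¬ (Σ (Fin k → Fin n) λ f →
                  Injective _≡_ _≡_ f × (∀ a b → adj G (f a) (f b) ≡ P a b))

fromEdges : {k : ℕ} → List (ℕ × ℕ) → Fin k → Fin k → Bool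
fromEdges es a b = any (λ { (i , j) → ((toℕ a ≡ᵇ i) ∧ (toℕ b ≡ᵇ j)) ∨ ((toℕ a ≡ᵇ j) ∧ (toℕ b ≡ᵇ i)) }) es

claw : Fin 4 → Fin 4 → Bool
claw = fromEdges ((0 , 1) ∷ (0 , 2) ∷ (0 , 3) ∷ [])

bull : Fin 5 → Fin 5 → Bool
bull = fromEdges ((0 , 1) ∷ (1 , 2) ∷ (0 , 2) ∷ (3 , 0) ∷ (4 , 1) ∷ [])

net : Fin 6 → Fin 6 → Bool
net = fromEdges ((0 , 1) ∷ (1 , 2) ∷ (0 , 2) ∷ (3 , 0) ∷ (4 , 1) ∷ (5 , 2) ∷ [])

antenna : Fin 6 → Fin 6 → Bool
antenna = fromEdges ((0 , 1) ∷ (1 , 2) ∷ (2 , 3) ∷ (3 , 0) ∷ (4 , 0) ∷ (4 , 1) ∷ (5 , 4) ∷ [])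

module Layers {n : ℕ} (G : Graph n) (u₀ u₁ : Fin n) where
  -- V(H) for H = G - U, U = N_G(u₀) \ {u₁}
  InH : Fin n → Set
  InH v = (v ≡ u₁) ⊎ (adj G u₀ v ≡ false)

  N : ℕ → Fin n → Set
  N i v = Dist G InH u₀ v i

  Clique : (Fin n → Set) → Set
  Clique X = ∀ x y → X x → X y → x ≢ y → Adj G x y

  IndepAtMost2 : (Fin n → Set) → Set
  IndepAtMost2 X = ¬ (Σ (Fin n) λ x → Σ (Fin n) λ y → Σ (Fin n) λ z →
                      X x × X y × X z × x ≢ y × x ≢ z × y ≢ z ×
                      adj G x y ≡ false × adj G x z ≡ false × adj G y z ≡ false)

-- Every vertex of N (suc i) has a
-- parent in N i, layers two or more apart are non-adjacent, and N 0 = {u₀}, N 1 = {u₁}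
-- because H keeps no other neighbour of u₀. Each claim is then proved layer by layer:
-- wherever the claimed adjacency fails, following parents downwards exhibits an induced
-- claw, bull, net or antenna. For (c), antenna-freeness makes the neighbourhoods in
-- N (suc i) of the vertices of N i nested, so one of them contains all the others; (d)
-- holds because claw- and net-freeness already make every N i a clique.
module Submission where

open import Defs
open import Data.Nat using (ℕ; zero; suc; _≤_; _∸_; _+_; z≤n; s≤s)
  renaming (_<_ to _<ℕ_)
open import Data.Nat.Properties using (<-cmp; ≤-refl; n≤1+n; allUpTo?)
open import Data.Fin using (Fin; _<_)
open import Data.Fin.Properties using (_<?_; all?; any?) renaming (<-cmp to <-cmpᶠ; _≟_ to _≟ᶠ_)
open import Data.Bool using (Bool; true; false)
open import Data.Bool.Properties using (¬-not) renaming (_≟_ to _≟ᵇ_)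
open import Data.Product using (Σ; _×_; ∃; _,_; proj₁; proj₂; uncurry)
open import Data.Sum using (inj₁; inj₂)
open import Data.Vec using (Vec; lookup; _∷_; [])
open import Data.List using (List; []; _∷_; allFin; cartesianProduct; filter)
open import Data.List.Relation.Unary.All as All using (All; _∷_; [])
open import Data.List.Relation.Unary.Any using (here; there)
open import Data.List.Membership.Propositional using (_∈_)
open import Data.List.Membership.Propositional.Properties
  using (∈-allFin; ∈-filter⁺; ∈-cartesianProduct⁺)
open import Data.Empty using (⊥; ⊥-elim)
open import Function.Definitions using (Injective)
open import Relation.Nullary using (Dec; yes; no; ¬?; _×-dec_; _⊎-dec_; contradiction)
open import Relation.Nullary.Decidable using (from-yes; map′)
open import Relation.Unary using (Decidable)
open import Relation.Binary using (tri<; tri≈; tri>)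
open import Relation.Binary.PropositionalEquality
  using (_≡_; _≢_; refl; trans; cong) renaming (sym to ≡-sym)

-- For concrete k these lists evaluate, so a proof of RealisesOnPairs below is a list of
-- adjacency facts for the pairs a < b in lexicographic order.
increasingPairs : ∀ k → List (Fin k × Fin k)
increasingPairs k = filter (uncurry _<?_) (cartesianProduct (allFin k) (allFin k))

∈-increasingPairs : ∀ {k} {a b : Fin k} → a < b → (a , b) ∈ increasingPairs k
∈-increasingPairs = ∈-filter⁺ (uncurry _<?_) (∈-cartesianProduct⁺ (∈-allFin _) (∈-allFin _))

module _ {k : ℕ} (P : Fin k → Fin k → Bool) where

  SimplePattern : Set
  SimplePattern = (∀ a b → P a b ≡ P b a) × (∀ a → P a a ≡ false)

  simplePattern? : Dec SimplePattern
  simplePattern? = all? (λ a → all? λ b → P a b ≟ᵇ P b a) ×-dec all? (λ a → P a a ≟ᵇ false)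

  Twins : Fin k → Fin k → Set
  Twins a b = ∀ c → P c a ≡ P c b

  twins? : ∀ a b → Dec (Twins a b)
  twins? a b = all? λ c → P c a ≟ᵇ P c b

  twinPairs : List (Fin k × Fin k)
  twinPairs = filter (uncurry twins?) (increasingPairs k)

claw-simple : SimplePattern claw
claw-simple = from-yes (simplePattern? claw)

bull-simple : SimplePattern bull
bull-simple = from-yes (simplePattern? bull)

net-simple : SimplePattern net
net-simple = from-yes (simplePattern? net)

antenna-simple : SimplePattern antenna
antenna-simple = from-yes (simplePattern? antenna)

module _ {n : ℕ} (G : Graph n) where

  adj-sym : ∀ {x y b} → adj G x y ≡ b → adj G y x ≡ b
  adj-sym {x} {y} = trans (sym G y x)

  Adj⇒¬nonadjacent : ∀ {x y} → Adj G x y → adj G x y ≡ false → ⊥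
  Adj⇒¬nonadjacent xy x≁y with trans (≡-sym xy) x≁y
  ... | ()

  ≢-by-neighbour : ∀ {x x′ y} → adj G x y ≡ false → Adj G x′ y → x ≢ x′
  ≢-by-neighbour x≁y x′y refl = Adj⇒¬nonadjacent x′y x≁y

  -- A map agreeing with P on adjacency can identify only twins of P, so distinctness
  -- must be supplied just for those: the leaves of the claw, and nothing for bull, net
  -- and antenna.
  module _ {k : ℕ} (P : Fin k → Fin k → Bool) (vs : Vec (Fin n) k) where

    RealisesOnPairs : Set
    RealisesOnPairs = All (λ (a , b) → adj G (lookup vs a) (lookup vs b) ≡ P a b) (increasingPairs k)

    SeparatesTwins : Set
    SeparatesTwins = All (λ (a , b) → lookup vs a ≢ lookup vs b) (twinPairs P)

  module _ {k : ℕ} {P : Fin k → Fin k → Bool} (P-simple : SimplePattern P)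
           {vs : Vec (Fin n) k} (r : RealisesOnPairs P vs) where

    private
      f : Fin k → Fin n
      f = lookup vs

    realises : ∀ a b → adj G (f a) (f b) ≡ P a b
    realises a b with <-cmpᶠ a b
    ... | tri< a<b _ _ = All.lookup r (∈-increasingPairs a<b)
    ... | tri≈ _ refl _ = trans (irrefl G (f a)) (≡-sym (proj₂ P-simple a))
    ... | tri> _ _ b<a = adj-sym (trans (All.lookup r (∈-increasingPairs b<a)) (proj₁ P-simple b a))

    ≡⇒twins : ∀ {a b} → f a ≡ f b → Twins P a b
    ≡⇒twins {a} {b} fa≡fb c =
      trans (≡-sym (realises c a)) (trans (cong (adj G (f c)) fa≡fb) (realises c b))

    module _ (s : SeparatesTwins P vs) where

      <⇒≢ : ∀ {a b} → a < b → f a ≢ f b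
      <⇒≢ {a} {b} a<b fa≡fb with twins? P a b
      ... | yes twins = All.lookup s (∈-filter⁺ (uncurry (twins? P)) (∈-increasingPairs a<b) twins) fa≡fb
      ... | no ¬twins = ¬twins (≡⇒twins fa≡fb)

      injective : Injective _≡_ _≡_ f
      injective {a} {b} fa≡fb with <-cmpᶠ a b
      ... | tri< a<b _ _ = contradiction fa≡fb (<⇒≢ a<b)
      ... | tri≈ _ a≡b _ = a≡b
      ... | tri> _ _ b<a = contradiction (≡-sym fa≡fb) (<⇒≢ b<a)

  noInducedCopy : ∀ {k} {P : Fin k → Fin k → Bool} → Free G k P → SimplePattern P →
                  (vs : Vec (Fin n) k) → RealisesOnPairs P vs → SeparatesTwins P vs → ⊥
  noInducedCopy free P-simple vs r s = free (lookup vs , injective P-simple {vs} r s , realises P-simple {vs} r)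

  module _ {S : Fin n → Set} where

    Walk-target : ∀ {u v k} → Walk G S u v k → S v
    Walk-target (nil s) = s
    Walk-target (cons _ _ w) = Walk-target w

    Walk-snoc : ∀ {u w v k} → Walk G S u w k → Adj G w v → S v → Walk G S u v (suc k)
    Walk-snoc (nil s) a sv = cons s a (nil sv)
    Walk-snoc (cons s a w) a′ sv = cons s a (Walk-snoc w a′ sv)

    Walk-unsnoc : ∀ {u v k} → Walk G S u v (suc k) → ∃ λ w → Walk G S u w k × Adj G w v
    Walk-unsnoc (cons s a (nil _)) = _ , nil s , a
    Walk-unsnoc (cons s a (cons s′ a′ w)) with Walk-unsnoc (cons s′ a′ w)
    ... | x , w′ , a″ = x , cons s a w′ , a″

    walk? : Decidable S → ∀ k u v → Dec (Walk G S u v k)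
    walk? S? zero u v with S? u | u ≟ᶠ v
    ... | yes s | yes refl = yes (nil s)
    ... | no ¬s | _ = no λ { (nil s) → ¬s s }
    ... | yes _ | no u≢v = no λ { (nil _) → u≢v refl }
    walk? S? (suc k) u v with S? u | any? (λ w → (adj G u w ≟ᵇ true) ×-dec walk? S? k w v)
    ... | yes s | yes (w , a , wk) = yes (cons s a wk)
    ... | no ¬s | _ = no λ { (cons s _ _) → ¬s s }
    ... | yes _ | no ¬step = no λ { (cons _ a wk) → ¬step (_ , a , wk) }

    module _ {u : Fin n} where

      Dist-parent : ∀ {v i} → Dist G S u v (suc i) → ∃ λ w → Dist G S u w i × Adj G w v
      Dist-parent {i = i} (wk , shortest) with Walk-unsnoc wk
      ... | w , wk′ , a =
        w , (wk′ , λ j j<i wj → shortest (suc j) (s≤s j<i) (Walk-snoc wj a (Walk-target wk))) , a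

      Dist-unique : ∀ {v i j} → Dist G S u v i → Dist G S u v j → i ≡ j
      Dist-unique {i = i} {j} (wi , shortestᵢ) (wj , shortestⱼ) with <-cmp i j
      ... | tri< i<j _ _ = contradiction wi (shortestⱼ i i<j)
      ... | tri≈ _ i≡j _ = i≡j
      ... | tri> _ _ j<i = contradiction wj (shortestᵢ j j<i)

      Dist-≢ : ∀ {x y i j} → Dist G S u x i → Dist G S u y j → i ≢ j → x ≢ y
      Dist-≢ dx dy i≢j refl = i≢j (Dist-unique dx dy)

      far-above : ∀ {x y i j} → Dist G S u x i → Dist G S u y j → suc i <ℕ j → adj G x y ≡ false
      far-above {x} {y} {i} (wx , _) (wy , shortest) i+1<j =
        ¬-not λ xy → shortest (suc i) i+1<j (Walk-snoc wx xy (Walk-target wy))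

      far-below : ∀ {x y i j} → Dist G S u x i → Dist G S u y j → suc j <ℕ i → adj G x y ≡ false
      far-below dx dy j+1<i = adj-sym (far-above dy dx j+1<i)

    dist? : Decidable S → ∀ u v i → Dec (Dist G S u v i)
    dist? S? u v i = walk? S? i u v ×-dec
      map′ (λ h j j<i → h j<i) (λ h {j} j<i → h j j<i) (allUpTo? (λ j → ¬? (walk? S? j u v)) i)

  NestedNeighbourhoods : (X Y : Fin n → Set) → Set
  NestedNeighbourhoods X Y = ∀ {w w′ y z} → X w → X w′ → Y y → Y z →
                             Adj G w′ y → adj G w y ≡ false → Adj G w z → Adj G w′ z

  nested⇒dominating : ∀ {X Y : Fin n → Set} → Decidable Y → NestedNeighbourhoods X Y →
                      (∀ {y} → Y y → ∃ λ w → X w × Adj G w y) → ∃ X →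
                      ∃ λ w → X w × ∀ y → Y y → Adj G w y
  nested⇒dominating {X} {Y} Y? nested covered (x₀ , Xx₀) =
    let w , Xw , dom = dominating (allFin n) in w , Xw , λ y → dom (∈-allFin y)
    where
    dominating : ∀ L → ∃ λ w → X w × ∀ {y} → y ∈ L → Y y → Adj G w y
    dominating [] = x₀ , Xx₀ , λ ()
    dominating (y ∷ L) with dominating L
    ... | w , Xw , dom with adj G w y in wy | Y? y
    ...   | true  | _      = w , Xw , λ { (here refl) _ → wy ; (there y∈L) → dom y∈L }
    ...   | false | no ¬Yy = w , Xw , λ { (here refl) Yy → contradiction Yy ¬Yy ; (there y∈L) → dom y∈L }
    ...   | false | yes Yy with covered Yy
    ...     | w′ , Xw′ , w′y = w′ , Xw′ , λ { (here refl) _ → w′y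
                                           ; (there z∈L) Yz → nested Xw Xw′ Yy Yz w′y wy (dom z∈L Yz) }

module LayerProperties {n : ℕ} (G : Graph n) (u₀ u₁ : Fin n) where
  open Layers G u₀ u₁

  N? : ∀ i → Decidable (N i)
  N? i v = dist? G (λ v → (v ≟ᶠ u₁) ⊎-dec (adj G u₀ v ≟ᵇ false)) u₀ v i

  parent : ∀ {i v} → N (suc i) v → ∃ λ w → N i w × Adj G w v
  parent = Dist-parent G

  N-zero : ∀ {x} → N 0 x → x ≡ u₀
  N-zero (nil _ , _) = refl

  N-one : ∀ {x} → N 1 x → x ≡ u₁
  N-one (cons _ _ (nil (inj₁ x≡u₁)) , _) = x≡u₁
  N-one (cons _ u₀x (nil (inj₂ u₀≁x)) , _) = ⊥-elim (Adj⇒¬nonadjacent G u₀x u₀≁x)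

  N-subsingleton : ∀ {i x y} → i ≤ 1 → N i x → N i y → x ≡ y
  N-subsingleton z≤n       nx ny = trans (N-zero nx) (≡-sym (N-zero ny))
  N-subsingleton (s≤s z≤n) nx ny = trans (N-one nx) (≡-sym (N-one ny))

  subsingleton-clique : ∀ {i} → i ≤ 1 → Clique (N i)
  subsingleton-clique i≤1 x y nx ny = contradiction (N-subsingleton i≤1 nx ny)

  Complete : ℕ → Set
  Complete i = ∀ x y → N (suc i) x → N i y → Adj G x y

  complete-to-subsingleton : ∀ {i} → i ≤ 1 → Complete i
  complete-to-subsingleton i≤1 x y nx ny with parent nx
  ... | w , nw , wx with N-subsingleton i≤1 nw ny
  ...   | refl = adj-sym G wx

  clique⇒indepAtMost2 : ∀ {X} → Clique X → IndepAtMost2 X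
  clique⇒indepAtMost2 clique (x , y , _ , Xx , Xy , _ , x≢y , _ , _ , x≁y , _) =
    Adj⇒¬nonadjacent G (clique x y Xx Xy x≢y) x≁y

  sibling-adjacent : Free G 4 claw → ∀ {i x y w} → N (2 + i) x → N (2 + i) y → x ≢ y →
                     N (suc i) w → Adj G w x → Adj G w y → Adj G x y
  sibling-adjacent fc {x = x} {y} {w} nx ny x≢y nw wx wy = ¬-not λ x≁y →
    let z , nz , zw = parent nw in
    noInducedCopy G fc claw-simple (w ∷ x ∷ y ∷ z ∷ [])
      (wx ∷ wy ∷ adj-sym G zw ∷ x≁y ∷ far-below G nx nz ≤-refl ∷ far-below G ny nz ≤-refl ∷ [])
      (x≢y ∷ Dist-≢ G nx nz (λ ()) ∷ Dist-≢ G ny nz (λ ()) ∷ [])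

  clique-N2 : Free G 4 claw → Clique (N 2)
  clique-N2 fc x y nx ny x≢y with parent nx | parent ny
  ... | w , nw , wx | w′ , nw′ , w′y with N-subsingleton (s≤s z≤n) nw nw′
  ...   | refl = sibling-adjacent fc nx ny x≢y nw wx w′y

  module ClawBullFree (fc : Free G 4 claw) (fb : Free G 5 bull) where

    clique-step : ∀ {k} → Complete (suc k) → Clique (N (2 + k))
    clique-step complete x y nx ny x≢y with parent ny
    ... | y′ , ny′ , y′y = sibling-adjacent fc nx ny x≢y ny′ (adj-sym G (complete x y′ nx ny′)) y′y

    complete-step : ∀ {k} → Clique (N (2 + k)) → Complete (suc k) → Complete (2 + k)
    complete-step clique complete x y nx ny with parent nx
    ... | x′ , nx′ , x′x with x′ ≟ᶠ y
    ...   | yes refl = adj-sym G x′x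
    ...   | no x′≢y = ¬-not λ x≁y →
      let w , nw , wx′ = parent nx′
          t , nt , tw  = parent nw
      in noInducedCopy G fb bull-simple (x′ ∷ w ∷ y ∷ x ∷ t ∷ [])
           (adj-sym G wx′ ∷ clique x′ y nx′ ny x′≢y ∷ x′x ∷ far-below G nx′ nt ≤-refl
           ∷ adj-sym G (complete y w ny nw) ∷ far-above G nw nx ≤-refl ∷ adj-sym G tw
           ∷ adj-sym G x≁y ∷ far-below G ny nt ≤-refl ∷ far-below G nx nt (n≤1+n _) ∷ [])
           []

    complete : ∀ i → Complete i
    complete zero          = complete-to-subsingleton z≤n
    complete (suc zero)    = complete-to-subsingleton (s≤s z≤n)
    complete (suc (suc k)) = complete-step (clique-step (complete (suc k))) (complete (suc k))

    clique : ∀ i → Clique (N i)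
    clique zero          = subsingleton-clique z≤n
    clique (suc zero)    = subsingleton-clique (s≤s z≤n)
    clique (suc (suc k)) = clique-step (complete (suc k))

  module ClawNetFree (fc : Free G 4 claw) (fn : Free G 6 net) where

    crossed-parents-impossible :
      ∀ {k x y x′ y′} → Clique (N (2 + k)) →
      N (3 + k) x → N (3 + k) y → N (2 + k) x′ → N (2 + k) y′ → x′ ≢ y′ → Adj G x′ x → Adj G y′ y →
      adj G x′ y ≡ false → adj G y′ x ≡ false → adj G x y ≡ false → ⊥
    crossed-parents-impossible {x = x} {y} {x′} {y′}
      clique nx ny nx′ ny′ x′≢y′ x′x y′y x′≁y y′≁x x≁y with parent nx′
    ... | w , nw , wx′ with adj G w y′ in wy′
    ...   | false =
      noInducedCopy G fc claw-simple (x′ ∷ x ∷ y′ ∷ w ∷ [])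
        (x′x ∷ clique x′ y′ nx′ ny′ x′≢y′ ∷ adj-sym G wx′ ∷ adj-sym G y′≁x
        ∷ far-below G nx nw ≤-refl ∷ adj-sym G wy′ ∷ [])
        (Dist-≢ G nx ny′ (λ ()) ∷ Dist-≢ G nx nw (λ ()) ∷ Dist-≢ G ny′ nw (λ ()) ∷ [])
    ...   | true with parent nw
    ...     | t , nt , tw =
      noInducedCopy G fn net-simple (w ∷ x′ ∷ y′ ∷ t ∷ x ∷ y ∷ [])
        (wx′ ∷ wy′ ∷ adj-sym G tw ∷ far-above G nw nx ≤-refl ∷ far-above G nw ny ≤-refl
        ∷ clique x′ y′ nx′ ny′ x′≢y′ ∷ far-below G nx′ nt ≤-refl ∷ x′x ∷ x′≁y
        ∷ far-below G ny′ nt ≤-refl ∷ y′≁x ∷ y′y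
        ∷ far-above G nt nx (n≤1+n _) ∷ far-above G nt ny (n≤1+n _) ∷ x≁y ∷ [])
        []

    clique-step : ∀ {k} → Clique (N (2 + k)) → Clique (N (3 + k))
    clique-step clique x y nx ny x≢y with parent nx | parent ny
    ... | x′ , nx′ , x′x | y′ , ny′ , y′y with x′ ≟ᶠ y′ | adj G x′ y in x′y | adj G y′ x in y′x
    ...   | yes refl  | _     | _     = sibling-adjacent fc nx ny x≢y nx′ x′x y′y
    ...   | no _      | true  | _     = sibling-adjacent fc nx ny x≢y nx′ x′x x′y
    ...   | no _      | false | true  = sibling-adjacent fc nx ny x≢y ny′ y′x y′y
    ...   | no x′≢y′ | false | false =
      ¬-not (crossed-parents-impossible clique nx ny nx′ ny′ x′≢y′ x′x y′y x′y y′x)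

    clique : ∀ i → Clique (N i)
    clique zero                = subsingleton-clique z≤n
    clique (suc zero)          = subsingleton-clique (s≤s z≤n)
    clique (suc (suc zero))    = clique-N2 fc
    clique (suc (suc (suc k))) = clique-step (clique (suc (suc k)))

  module ClawNetAntennaFree (fc : Free G 4 claw) (fn : Free G 6 net) (fa : Free G 6 antenna) where
    open ClawNetFree fc fn

    nested : ∀ i → NestedNeighbourhoods G (N i) (N (suc i))
    nested i nw nw′ ny nz w′y w≁y wz = ¬-not (noDiscordantEdge i nw nw′ ny nz w′y w≁y wz)
      where
      noDiscordantEdge : ∀ i {w w′ y z} → N i w → N i w′ → N (suc i) y → N (suc i) z →
                         Adj G w′ y → adj G w y ≡ false → Adj G w z → adj G w′ z ≡ false → ⊥
      noDiscordantEdge zero nw nw′ _ _ w′y w≁y _ _ =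
        ≢-by-neighbour G w≁y w′y (N-subsingleton z≤n nw nw′)
      noDiscordantEdge (suc zero) nw nw′ _ _ w′y w≁y _ _ =
        ≢-by-neighbour G w≁y w′y (N-subsingleton (s≤s z≤n) nw nw′)
      noDiscordantEdge (suc (suc k)) {w} {w′} {y} {z} nw nw′ ny nz w′y w≁y wz w′≁z
        with parent nw | clique _ w w′ nw nw′ (≢-by-neighbour G w≁y w′y)
      ... | c , nc , cw | ww′ with adj G c w′ in cw′
      ...   | false =
        noInducedCopy G fc claw-simple (w ∷ c ∷ w′ ∷ z ∷ [])
          (adj-sym G cw ∷ ww′ ∷ wz ∷ cw′ ∷ far-above G nc nz ≤-refl ∷ w′≁z ∷ [])
          (Dist-≢ G nc nw′ (λ ()) ∷ Dist-≢ G nc nz (λ ()) ∷ Dist-≢ G nw′ nz (λ ()) ∷ [])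
      ...   | true with parent nc
      ...     | d , nd , dc =
        noInducedCopy G fa antenna-simple (w ∷ w′ ∷ y ∷ z ∷ c ∷ d ∷ [])
          (ww′ ∷ w≁y ∷ wz ∷ adj-sym G cw ∷ far-below G nw nd ≤-refl
          ∷ w′y ∷ w′≁z ∷ adj-sym G cw′ ∷ far-below G nw′ nd ≤-refl
          ∷ clique _ y z ny nz (≢-by-neighbour G (adj-sym G w≁y) (adj-sym G wz))
          ∷ far-below G ny nc ≤-refl ∷ far-below G ny nd (n≤1+n _)
          ∷ far-below G nz nc ≤-refl ∷ far-below G nz nd (n≤1+n _) ∷ adj-sym G dc ∷ [])
          []

    dominating : ∀ i → ∃ (N i) → ∃ λ w → N i w × ∀ y → N (suc i) y → Adj G w y
    dominating i = nested⇒dominating G (N? (suc i)) (nested i) parent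

lemma4 : ∀ {n} (G : Graph n) → Connected G → 2 ≤ n →
    (u₀ u₁ : Fin n) → Adj G u₀ u₁ →
    let open Layers G u₀ u₁ in
    -- (a)
    ((Free G 4 claw →
       (∀ i → 2 ≤ i → ∀ x y w → N i x → N i y → x ≢ y →
          N (i ∸ 1) w → Adj G w x → Adj G w y → Adj G x y)
       × Clique (N 2))
    -- (b)
    × (Free G 4 claw → Free G 5 bull →
       (∀ i → Clique (N i))
       × (∀ i → 1 ≤ i → ∀ x y → N i x → N (i ∸ 1) y → Adj G x y))
    -- (c)
    × (Free G 4 claw → Free G 6 net → Free G 6 antenna →
       (∀ i → Clique (N i))
       × (∀ i → (∃ λ v → N i v) →
            Σ (Fin n) λ w → N i w × (∀ y → N (suc i) y → Adj G w y)))
    -- (d)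
    × (Free G 4 claw → Free G 6 net → ∀ i → IndepAtMost2 (N i)))
lemma4 G _ _ u₀ u₁ _ =
    (λ fc → (λ { (suc zero) (s≤s ()) ; (suc (suc i)) _ _ _ _ → sibling-adjacent fc }) , clique-N2 fc)
  , (λ fc fb → let open ClawBullFree fc fb in clique , λ { (suc i) _ → complete i })
  , (λ fc fn fa → ClawNetFree.clique fc fn , ClawNetAntennaFree.dominating fc fn fa)
  , (λ fc fn i → clique⇒indepAtMost2 (ClawNetFree.clique fc fn i))
  where open LayerProperties G u₀ u₁
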